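{- Let $\alpha\vDash n$. Then \[\mathcal{R}\mathfrak{S}^*_\alpha=\sum_{S}F_{\mathrm{comp}(\mathrm{Des}_{\mathcal R\mathfrak S^*}(S))},\] where the sum is over all standard row-strict immaculate tableaux $S$ of shape $\alpha$.
   Context: For a composition $\alpha=(\alpha_1,\dots,\alpha_k)$ of $n$, its diagram has $\alpha_i$ left-justified boxes in row $i$, row 1 at the bottom. A row-strict immaculate tableau of shape $\alpha$ is a filling of the diagram with positive integers such that the entries of the leftmost column weakly increase from bottom to top and entries in each row strictly increase from left to right. Its content monomial is $x^U=\prod_i x_i^{(\#\text{ of } i\text{'s in }U)}$. The row-strict dual immaculate function is $\mathcal R\mathfrak S^*_\alpha=\sum_U x^U$ over all row-strict immaculate tableaux $U$ of shape $\alpha$. A row-strict immaculate tableau is standard if it uses each of $1,\dots,n$ exactly once. For a standard such $S$, $\mathrm{Des}_{\mathcal R\mathfrak S^*}(S)=\{i: i+1\text{ is weakly below } i\text{ in } S\}\subseteq\{1,\dots,n-1\}$. For $D\subseteq\{1,\dots,n-1\}$ with $D=\{s_1<\dots<s_j\}$, $\mathrm{comp}(D)=(s_1,s_2-s_1,\dots,n-s_j)$. The fundamental quasisymmetric function of $\beta\vDash n$ is $F_\beta=\sum x_{i_1}\cdots x_{i_n}$ over $i_1\le\cdots\le i_n$ with $i_j=i_{j+1}\Rightarrow j\notin\mathrm{set}(\beta)$, where $\mathrm{set}(\beta)=\{\beta_1,\beta_1+\beta_2,\dots,\beta_1+\dots+\beta_{\ell(\beta)-1}\}$. -}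

module Defs where

open import Data.Nat using (ℕ; zero; suc; _+_; _∸_; _≤_; _<_; _≤?_; _<?_)
open import Data.Nat.Properties using (_≟_)
open import Data.List using (List; []; _∷_; map; concat; concatMap; length; filter; upTo; take; drop)
open import Data.Nat.ListAction using (sum)
open import Data.List.Properties using (≡-dec)
open import Data.List.Relation.Unary.All using (All; all?)
open import Data.List.Relation.Unary.Linked using (Linked; linked?)
open import Data.List.Membership.DecPropositional _≟_ using (_∈?_; _∉_)
open import Data.Product using (_×_)
open import Data.Unit using (⊤; tt)
open import Data.Bool using (if_then_else_)
open import Relation.Nullary using (Dec; yes; no; ¬_)
open import Relation.Nullary.Decidable using (_×-dec_; _→-dec_; ¬?; does)
open import Relation.Binary.PropositionalEquality using (_≡_)

-- A filling / tableau is a list of rows, row 1 (the BOTTOM row) first;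
-- each row is listed from left to right.
-- A monomial x_1^{m_1} ... x_k^{m_k} is represented by the list
-- m = (m_1, ..., m_k) of its exponents (k = length m).  Every monomial
-- is of this form, so two formal power series are equal iff all their
-- coefficients at such m agree.

Tableau : Set
Tableau = List (List ℕ)

oneTo : ℕ → List ℕ
oneTo k = map suc (upTo k)

wordsOf : ℕ → ℕ → List (List ℕ)
wordsOf k zero    = [] ∷ []
wordsOf k (suc a) = concatMap (λ x → map (x ∷_) (wordsOf k a)) (oneTo k)

fillings : ℕ → List ℕ → List Tableau
fillings k []      = [] ∷ []
fillings k (a ∷ α) = concatMap (λ r → map (r ∷_) (fillings k α)) (wordsOf k a)

firstColumn : Tableau → List ℕ
firstColumn U = concatMap (take 1) U

IsRowStrictImmaculate : Tableau → Set
IsRowStrictImmaculate U =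
  All (All (λ x → 1 ≤ x)) U × Linked _≤_ (firstColumn U) × All (Linked _<_) U

isRowStrictImmaculate? : (U : Tableau) → Dec (IsRowStrictImmaculate U)
isRowStrictImmaculate? U =
  all? (all? (λ x → 1 ≤? x)) U ×-dec linked? _≤?_ (firstColumn U) ×-dec all? (linked? _<?_) U

occurrences : ℕ → List ℕ → ℕ
occurrences v xs = length (filter (λ y → v ≟ y) xs)

contentUpTo : ℕ → Tableau → List ℕ
contentUpTo k U = map (λ v → occurrences v (concat U)) (oneTo k)

-- U is a row-strict immaculate tableau with x^U = x_1^{m_1}...x_k^{m_k}
-- (entries are restricted to {1..k} by the enumeration `fillings`,
--  which is forced since x_j does not occur for j > k)
HasContent : List ℕ → Tableau → Set
HasContent m U = IsRowStrictImmaculate U × contentUpTo (length m) U ≡ m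

hasContent? : (m : List ℕ) → (U : Tableau) → Dec (HasContent m U)
hasContent? m U = isRowStrictImmaculate? U ×-dec ≡-dec _≟_ (contentUpTo (length m) U) m

coeffRS : List ℕ → List ℕ → ℕ
coeffRS α m = length (filter (hasContent? m) (fillings (length m) α))

ones : ℕ → List ℕ
ones zero    = []
ones (suc n) = 1 ∷ ones n

-- standard row-strict immaculate tableaux of shape α (n = sum α):
-- row-strict immaculate tableaux using each of 1..n exactly once
standardTableaux : List ℕ → List Tableau
standardTableaux α = filter (hasContent? (ones (sum α))) (fillings (sum α) α)

-- index (0 = bottom row) of the row containing v
rowOf : ℕ → Tableau → ℕ
rowOf v []       = 0
rowOf v (r ∷ rs) = if does (v ∈? r) then 0 else suc (rowOf v rs)

descents : ℕ → Tableau → List ℕ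
descents n S = filter (λ i → rowOf (suc i) S ≤? rowOf i S) (oneTo (n ∸ 1))

compAux : ℕ → ℕ → List ℕ → List ℕ
compAux n prev []       = (n ∸ prev) ∷ []
compAux n prev (s ∷ ss) = (s ∸ prev) ∷ compAux n s ss

comp : ℕ → List ℕ → List ℕ
comp n D = compAux n 0 D

setAux : ℕ → List ℕ → List ℕ
setAux acc []           = []
setAux acc (b ∷ [])     = []
setAux acc (b ∷ c ∷ cs) = (acc + b) ∷ setAux (acc + b) (c ∷ cs)

setOf : List ℕ → List ℕ
setOf β = setAux 0 β

Admissible : List ℕ → ℕ → List ℕ → Set
Admissible s j []           = ⊤
Admissible s j (x ∷ [])     = ⊤
Admissible s j (x ∷ y ∷ zs) = (x ≤ y) × ((x ≡ y) → j ∉ s) × Admissible s (suc j) (y ∷ zs)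

admissible? : (s : List ℕ) → (j : ℕ) → (w : List ℕ) → Dec (Admissible s j w)
admissible? s j []           = yes tt
admissible? s j (x ∷ [])     = yes tt
admissible? s j (x ∷ y ∷ zs) =
  (x ≤? y) ×-dec ((x ≟ y) →-dec ¬? (j ∈? s)) ×-dec admissible? s (suc j) (y ∷ zs)

-- i_1 ... i_n is an index sequence of a term of F_β whose monomial is
-- x_1^{m_1}...x_k^{m_k}
FTerm : List ℕ → List ℕ → List ℕ → Set
FTerm β m w = Admissible (setOf β) 1 w × map (λ v → occurrences v w) (oneTo (length m)) ≡ m

fTerm? : (β m w : List ℕ) → Dec (FTerm β m w)
fTerm? β m w = admissible? (setOf β) 1 w ×-dec ≡-dec _≟_ (map (λ v → occurrences v w) (oneTo (length m))) m

coeffF : List ℕ → List ℕ → ℕ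
coeffF β m = length (filter (fTerm? β m) (wordsOf (length m) (sum β)))

module Submission where

-- The coefficient of x^m in F_β is 0 or 1: a term of F_β is a weakly increasing word, so the only
-- candidate is the sorted word w with content m, and it is a term iff w strictly increases at each
-- element of set(β). For β = comp(Des S) this says: whenever positions j and j + 1 of w carry the
-- same letter, j + 1 lies strictly above j in S. Standardization, which relabels the copies of each
-- letter from the bottom row up by the consecutive positions of its block in w, is a bijection from
-- the row-strict immaculate tableaux of content m onto the standard ones with this property; its
-- inverse replaces every entry L by the L-th letter of w.

open import Defs
open import Data.Nat using (ℕ; zero; suc; _+_; _∸_; _≤_; _<_; _≤?_; _<?_; z≤n; s≤s)
open import Data.Nat.Properties
open import Data.Nat.ListAction using (sum)
open import Data.List using (List; []; _∷_; _++_; map; filter; length; concat; concatMap; take; upTo; applyUpTo; cartesianProductWith)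
open import Data.List.Properties using (length-map; length-++; length-upTo; ++-assoc; ++-identityʳ; concat-map; concat-++; map-++; map-∘; map-cong; map-id-local; ∷-injective; filter-accept; filter-reject; filter-++; map-applyUpTo)
open import Data.List.Membership.DecPropositional _≟_ using (_∈?_)
open import Data.List.Membership.Propositional using (_∈_; _∉_)
open import Data.List.Membership.Propositional.Properties
  using (∈-filter⁺; ∈-filter⁻; ∈-map⁺; ∈-map⁻; ∈-++⁺ˡ; ∈-++⁺ʳ; ∈-++⁻; ∈-upTo⁺; ∈-upTo⁻;
         ∈-cartesianProductWith⁺; ∈-cartesianProductWith⁻; ∈-concat⁺′)
open import Data.List.Membership.Propositional.Properties.WithK using (unique∧set⇒bag)
open import Data.List.Relation.Binary.BagAndSetEquality using (∼bag⇒↭)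
open import Data.List.Relation.Binary.Permutation.Propositional.Properties using (↭-length)
open import Data.List.Relation.Unary.Any using (here; there)
open import Data.List.Relation.Unary.All as All using (All; []; _∷_)
open import Data.List.Relation.Unary.AllPairs as AllPairs using ([]; _∷_)
open import Data.List.Relation.Unary.Linked as Linked using (Linked; [-])
open import Data.List.Relation.Unary.Linked.Properties using (Linked⇒All; Linked⇒AllPairs; applyUpTo⁺₁; ∷-filter⁺)
import Data.List.Relation.Unary.All.Properties as All
open import Relation.Binary.Definitions using (tri<; tri≈; tri>)
open import Data.List.Relation.Unary.Unique.Propositional using (Unique)
import Data.List.Relation.Unary.Unique.Propositional.Properties as Unique
open import Data.Product using (_×_; _,_; proj₁; proj₂; Σ-syntax)
open import Data.Sum using (inj₁; inj₂)
open import Data.Empty using (⊥-elim)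
open import Function using (_∘_)
open import Function.Bundles using (mk⇔; _⇔_; Equivalence)
open import Relation.Nullary using (Dec; yes; no; ¬_)
open import Relation.Unary using (Decidable)
open import Relation.Binary.PropositionalEquality using (_≡_; _≢_; refl; sym; trans; cong; cong₂; subst; subst₂; module ≡-Reasoning)
open import Relation.Nullary.Decidable using (_×-dec_; dec-true; dec-false)
open import Data.Bool using (if_then_else_)

length-≡-of-same-elements : ∀ {A : Set} {xs ys : List A} → Unique xs → Unique ys →
  (∀ {z} → z ∈ xs → z ∈ ys) → (∀ {z} → z ∈ ys → z ∈ xs) → length xs ≡ length ys
length-≡-of-same-elements uxs uys to from =
  ↭-length (∼bag⇒↭ (unique∧set⇒bag uxs uys (mk⇔ to from)))

module _ {A B : Set} {P : A → Set} {Q : B → Set} (P? : Decidable P) (Q? : Decidable Q) where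

  length-filter-≡-by-inverses : (xs : List A) (ys : List B) → Unique xs → Unique ys →
    (f : A → B) (g : B → A) →
    (∀ x → x ∈ xs → P x → (f x ∈ ys × Q (f x)) × g (f x) ≡ x) →
    (∀ y → y ∈ ys → Q y → (g y ∈ xs × P (g y)) × f (g y) ≡ y) →
    length (filter P? xs) ≡ length (filter Q? ys)
  length-filter-≡-by-inverses xs ys uxs uys f g f-ok g-ok =
    trans (sym (length-map f (filter P? xs))) (length-≡-of-same-elements f-unique (Unique.filter⁺ Q? uys) to from)
    where
    g∘f≡id : map g (map f (filter P? xs)) ≡ filter P? xs
    g∘f≡id = trans (sym (map-∘ (filter P? xs)))
      (map-id-local (All.tabulate λ x∈ → let (x∈xs , px) = ∈-filter⁻ P? x∈ in proj₂ (f-ok _ x∈xs px)))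
    f-unique : Unique (map f (filter P? xs))
    f-unique = Unique.map⁻ (subst Unique (sym g∘f≡id) (Unique.filter⁺ P? uxs))
    to : ∀ {y} → y ∈ map f (filter P? xs) → y ∈ filter Q? ys
    to y∈ with ∈-map⁻ f y∈
    ... | x , x∈ , refl = let (x∈xs , px) = ∈-filter⁻ P? x∈ ; ((fx∈ , qfx) , _) = f-ok x x∈xs px in ∈-filter⁺ Q? fx∈ qfx
    from : ∀ {y} → y ∈ filter Q? ys → y ∈ map f (filter P? xs)
    from {y} y∈ =
      let (y∈ys , qy) = ∈-filter⁻ Q? y∈ ; ((gy∈ , pgy) , fgy≡y) = g-ok y y∈ys qy
      in subst (_∈ map f (filter P? xs)) fgy≡y (∈-map⁺ f (∈-filter⁺ P? gy∈ pgy))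

++-unique⇒disjoint : ∀ {A : Set} xs {ys : List A} {x} → Unique (xs ++ ys) → x ∈ xs → x ∉ ys
++-unique⇒disjoint (x ∷ xs) (x∉ ∷ _) (here refl) x∈ys = All.lookup x∉ (∈-++⁺ʳ xs x∈ys) refl
++-unique⇒disjoint (_ ∷ xs) (_ ∷ u) (there x∈) = ++-unique⇒disjoint xs u x∈

++-unique⇒uniqueʳ : ∀ {A : Set} xs {ys : List A} → Unique (xs ++ ys) → Unique ys
++-unique⇒uniqueʳ [] u = u
++-unique⇒uniqueʳ (_ ∷ xs) (_ ∷ u) = ++-unique⇒uniqueʳ xs u

++-unique⇒uniqueˡ : ∀ {A : Set} xs {ys : List A} → Unique (xs ++ ys) → Unique xs
++-unique⇒uniqueˡ [] _ = []
++-unique⇒uniqueˡ (x ∷ xs) (x∉ ∷ u) = All.++⁻ˡ xs x∉ ∷ ++-unique⇒uniqueˡ xs u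

strict⇒unique : ∀ {xs} → Linked _<_ xs → Unique xs
strict⇒unique sorted = AllPairs.map (λ x<y x≡y → <⇒≢ x<y x≡y) (Linked⇒AllPairs <-trans sorted)

InRange : ℕ → ℕ → Set
InRange n x = 1 ≤ x × x ≤ n

∈-oneTo⁺ : ∀ {n x} → InRange n x → x ∈ oneTo n
∈-oneTo⁺ {x = suc x} (_ , x≤n) = ∈-map⁺ suc (∈-upTo⁺ x≤n)

∈-oneTo⁻ : ∀ {n x} → x ∈ oneTo n → InRange n x
∈-oneTo⁻ x∈ with ∈-map⁻ suc x∈
... | _ , i∈ , refl = s≤s z≤n , ∈-upTo⁻ i∈

oneTo-unique : ∀ n → Unique (oneTo n)
oneTo-unique n = Unique.map⁺ suc-injective (Unique.upTo⁺ n)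

length-oneTo : ∀ n → length (oneTo n) ≡ n
length-oneTo n = trans (length-map suc (upTo n)) (length-upTo n)

interval : ℕ → ℕ → List ℕ
interval a c = map (a +_) (oneTo c)

∈-interval⁺ : ∀ {a c x} → a < x → x ≤ a + c → x ∈ interval a c
∈-interval⁺ {a} {c} {x} a<x x≤a+c = subst (_∈ interval a c) (m+[n∸m]≡n (<⇒≤ a<x))
  (∈-map⁺ (a +_) (∈-oneTo⁺ (m<n⇒0<n∸m a<x , subst (x ∸ a ≤_) (m+n∸m≡n a c) (∸-monoˡ-≤ a x≤a+c))))

∈-interval⁻ : ∀ {a c x} → x ∈ interval a c → a < x × x ≤ a + c
∈-interval⁻ {a} x∈ with ∈-map⁻ (a +_) x∈
... | d , d∈ , refl = let (1≤d , d≤c) = ∈-oneTo⁻ d∈ in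
  subst (_≤ a + d) (+-comm a 1) (+-monoʳ-≤ a 1≤d) , +-monoʳ-≤ a d≤c

interval-unique : ∀ a c → Unique (interval a c)
interval-unique a c = Unique.map⁺ (+-cancelˡ-≡ a _ _) (oneTo-unique c)

length-interval : ∀ a c → length (interval a c) ≡ c
length-interval a c = trans (length-map (a +_) (oneTo c)) (length-oneTo c)

occurrences-here : ∀ x xs → occurrences x (x ∷ xs) ≡ suc (occurrences x xs)
occurrences-here x xs = cong length (filter-accept (x ≟_) refl)

occurrences-there : ∀ {v x} xs → v ≢ x → occurrences v (x ∷ xs) ≡ occurrences v xs
occurrences-there {v} xs v≢x = cong length (filter-reject (v ≟_) v≢x)

occurrences-++ : ∀ v xs ys → occurrences v (xs ++ ys) ≡ occurrences v xs + occurrences v ys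
occurrences-++ v xs ys = trans (cong length (filter-++ (v ≟_) xs ys)) (length-++ (filter (v ≟_) xs))

occurrences-map : ∀ (f : ℕ → ℕ) v xs → occurrences v (map f xs) ≡ length (filter (λ z → v ≟ f z) xs)
occurrences-map f v [] = refl
occurrences-map f v (x ∷ xs) with v ≟ f x
... | yes v≡fx = trans (cong length (filter-accept (v ≟_) v≡fx))
  (trans (cong suc (occurrences-map f v xs)) (sym (cong length (filter-accept (λ z → v ≟ f z) v≡fx))))
... | no v≢fx = trans (cong length (filter-reject (v ≟_) v≢fx))
  (trans (occurrences-map f v xs) (sym (cong length (filter-reject (λ z → v ≟ f z) v≢fx))))

occurrences-∉ : ∀ {v} xs → v ∉ xs → occurrences v xs ≡ 0
occurrences-∉ [] v∉ = refl
occurrences-∉ (x ∷ xs) v∉ = trans (occurrences-there xs (v∉ ∘ here)) (occurrences-∉ xs (v∉ ∘ there))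

occurrences-outside : ∀ {k v xs} → All (InRange k) xs → ¬ InRange k v → occurrences v xs ≡ 0
occurrences-outside {xs = xs} inRange v∉ = occurrences-∉ xs (λ v∈ → v∉ (All.lookup inRange v∈))

occurrences-∈ : ∀ {v} xs → v ∈ xs → 1 ≤ occurrences v xs
occurrences-∈ (x ∷ xs) (here refl) = subst (1 ≤_) (sym (occurrences-here x xs)) (s≤s z≤n)
occurrences-∈ {v} (x ∷ xs) (there v∈) with v ≟ x
... | yes refl = subst (1 ≤_) (sym (occurrences-here x xs)) (s≤s z≤n)
... | no v≢x = subst (1 ≤_) (sym (occurrences-there xs v≢x)) (occurrences-∈ xs v∈)

occurrences-∈-unique : ∀ {v xs} → Unique xs → v ∈ xs → occurrences v xs ≡ 1
occurrences-∈-unique {xs = x ∷ xs} (x∉xs ∷ _) (here refl) =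
  trans (occurrences-here x xs) (cong suc (occurrences-∉ xs λ x∈ → All.lookup x∉xs x∈ refl))
occurrences-∈-unique {xs = x ∷ xs} (x∉xs ∷ uxs) (there v∈) =
  trans (occurrences-there xs λ { refl → All.lookup x∉xs v∈ refl }) (occurrences-∈-unique uxs v∈)

unique⇒occurrences≤1 : ∀ {xs} → Unique xs → ∀ v → occurrences v xs ≤ 1
unique⇒occurrences≤1 {xs} uxs v with v ∈? xs
... | yes v∈ = ≤-reflexive (occurrences-∈-unique uxs v∈)
... | no v∉ = subst (_≤ 1) (sym (occurrences-∉ xs v∉)) z≤n

occurrences≤1⇒unique : ∀ xs → (∀ v → occurrences v xs ≤ 1) → Unique xs
occurrences≤1⇒unique [] _ = []
occurrences≤1⇒unique (x ∷ xs) occ≤1 =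
  All.tabulate twice ∷ occurrences≤1⇒unique xs (λ v → ≤-trans (fewer v) (occ≤1 v))
  where
  twice : ∀ {x′} → x′ ∈ xs → x ≢ x′
  twice x∈ refl = <-irrefl refl (≤-trans (s≤s (occurrences-∈ xs x∈)) (≤-trans (≤-reflexive (sym (occurrences-here x xs))) (occ≤1 x)))
  fewer : ∀ v → occurrences v xs ≤ occurrences v (x ∷ xs)
  fewer v with v ≟ x
  ... | yes refl = subst (occurrences x xs ≤_) (sym (occurrences-here x xs)) (n≤1+n _)
  ... | no v≢x = ≤-reflexive (sym (occurrences-there xs v≢x))

occurrences-∷-cancel : ∀ {x xs ys} → (∀ v → occurrences v (x ∷ xs) ≡ occurrences v (x ∷ ys)) →
  ∀ v → occurrences v xs ≡ occurrences v ys
occurrences-∷-cancel {x} {xs} {ys} same v with v ≟ x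
... | yes refl = suc-injective (trans (sym (occurrences-here x xs)) (trans (same x) (occurrences-here x ys)))
... | no v≢x = trans (sym (occurrences-there xs v≢x)) (trans (same v) (occurrences-there ys v≢x))

below-head-∉ : ∀ {x y ys} → Linked _≤_ (y ∷ ys) → x < y → x ∉ y ∷ ys
below-head-∉ sorted x<y x∈ = <⇒≱ x<y (All.lookup (Linked⇒All ≤-trans ≤-refl sorted) x∈)

sorted-≡ : ∀ xs ys → Linked _≤_ xs → Linked _≤_ ys → (∀ v → occurrences v xs ≡ occurrences v ys) → xs ≡ ys
sorted-≡ [] [] _ _ _ = refl
sorted-≡ [] (y ∷ ys) _ _ same = ⊥-elim (0≢1+n (trans (same y) (occurrences-here y ys)))
sorted-≡ (x ∷ xs) [] _ _ same = ⊥-elim (0≢1+n (trans (sym (same x)) (occurrences-here x xs)))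
sorted-≡ (x ∷ xs) (y ∷ ys) sxs sys same with <-cmp x y
... | tri< x<y _ _ = ⊥-elim (0≢1+n (trans (sym (occurrences-∉ (y ∷ ys) (below-head-∉ sys x<y)))
                                      (trans (sym (same x)) (occurrences-here x xs))))
... | tri> _ _ y<x = ⊥-elim (0≢1+n (trans (sym (occurrences-∉ (x ∷ xs) (below-head-∉ sxs y<x)))
                                      (trans (same y) (occurrences-here y ys))))
... | tri≈ _ refl _ = cong (x ∷_) (sorted-≡ xs ys (Linked.tail sxs) (Linked.tail sys) (occurrences-∷-cancel same))

module _ {A : Set} (xs : List A) (yss : List (List A)) where

  private
    consProduct≡ : concatMap (λ x → map (x ∷_) yss) xs ≡ cartesianProductWith _∷_ xs yss
    consProduct≡ = go xs
      where
      go : ∀ xs → concatMap (λ x → map (x ∷_) yss) xs ≡ cartesianProductWith _∷_ xs yss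
      go [] = refl
      go (x ∷ xs) = cong (map (x ∷_) yss ++_) (go xs)

  ∈-concatMap-∷⁺ : ∀ {x ys} → x ∈ xs → ys ∈ yss → x ∷ ys ∈ concatMap (λ x → map (x ∷_) yss) xs
  ∈-concatMap-∷⁺ x∈ ys∈ = subst (_ ∈_) (sym consProduct≡) (∈-cartesianProductWith⁺ _∷_ x∈ ys∈)

  ∈-concatMap-∷⁻ : ∀ {zs} → zs ∈ concatMap (λ x → map (x ∷_) yss) xs →
    Σ[ x ∈ A ] Σ[ ys ∈ List A ] x ∈ xs × ys ∈ yss × zs ≡ x ∷ ys
  ∈-concatMap-∷⁻ zs∈ = ∈-cartesianProductWith⁻ _∷_ xs yss (subst (_ ∈_) consProduct≡ zs∈)

  concatMap-∷-unique : Unique xs → Unique yss → Unique (concatMap (λ x → map (x ∷_) yss) xs)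
  concatMap-∷-unique uxs uyss = subst Unique (sym consProduct≡) (Unique.cartesianProductWith⁺ _∷_ ∷-injective uxs uyss)

∈-wordsOf⁺ : ∀ {k} w → All (InRange k) w → w ∈ wordsOf k (length w)
∈-wordsOf⁺ [] [] = here refl
∈-wordsOf⁺ {k} (x ∷ w) (x∈ ∷ w∈) = ∈-concatMap-∷⁺ (oneTo k) (wordsOf k (length w)) (∈-oneTo⁺ x∈) (∈-wordsOf⁺ w w∈)

∈-wordsOf⁻ : ∀ {k} a {w} → w ∈ wordsOf k a → length w ≡ a × All (InRange k) w
∈-wordsOf⁻ zero (here refl) = refl , []
∈-wordsOf⁻ {k} (suc a) w∈ with ∈-concatMap-∷⁻ (oneTo k) (wordsOf k a) w∈
... | x , w , x∈ , w∈ , refl = let (len , inRange) = ∈-wordsOf⁻ a w∈ in cong suc len , ∈-oneTo⁻ x∈ ∷ inRange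

wordsOf-unique : ∀ k a → Unique (wordsOf k a)
wordsOf-unique k zero = [] ∷ []
wordsOf-unique k (suc a) = concatMap-∷-unique (oneTo k) (wordsOf k a) (oneTo-unique k) (wordsOf-unique k a)

∈-fillings⁺ : ∀ {k} U → All (All (InRange k)) U → U ∈ fillings k (map length U)
∈-fillings⁺ [] [] = here refl
∈-fillings⁺ {k} (r ∷ U) (r∈ ∷ U∈) =
  ∈-concatMap-∷⁺ (wordsOf k (length r)) (fillings k (map length U)) (∈-wordsOf⁺ r r∈) (∈-fillings⁺ U U∈)

∈-fillings⁻ : ∀ {k} α {U} → U ∈ fillings k α → map length U ≡ α × All (All (InRange k)) U
∈-fillings⁻ [] (here refl) = refl , []
∈-fillings⁻ {k} (a ∷ α) U∈ with ∈-concatMap-∷⁻ (wordsOf k a) (fillings k α) U∈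
... | r , U , r∈ , U∈ , refl =
  let (len , r-inRange) = ∈-wordsOf⁻ a r∈ ; (shape , U-inRange) = ∈-fillings⁻ α U∈
  in cong₂ _∷_ len shape , r-inRange ∷ U-inRange

fillings-unique : ∀ k α → Unique (fillings k α)
fillings-unique k [] = [] ∷ []
fillings-unique k (a ∷ α) = concatMap-∷-unique (wordsOf k a) (fillings k α) (wordsOf-unique k a) (fillings-unique k α)

entry : List ℕ → ℕ → ℕ
entry [] y = 0
entry (c ∷ cs) zero = c
entry (c ∷ cs) (suc y) = entry cs y

map-oneTo : ∀ (f : ℕ → ℕ) k → map f (oneTo k) ≡ applyUpTo (f ∘ suc) k
map-oneTo f k = trans (cong (map f) (map-applyUpTo (λ i → i) suc k)) (map-applyUpTo suc f k)

applyUpTo-length≡⇒ : ∀ (g : ℕ → ℕ) m → applyUpTo g (length m) ≡ m → ∀ y → y < length m → g y ≡ entry m y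
applyUpTo-length≡⇒ g (c ∷ cs) eq zero _ = proj₁ (∷-injective eq)
applyUpTo-length≡⇒ g (c ∷ cs) eq (suc y) (s≤s y<) = applyUpTo-length≡⇒ (g ∘ suc) cs (proj₂ (∷-injective eq)) y y<

applyUpTo-length≡⇐ : ∀ (g : ℕ → ℕ) m → (∀ y → y < length m → g y ≡ entry m y) → applyUpTo g (length m) ≡ m
applyUpTo-length≡⇐ g [] _ = refl
applyUpTo-length≡⇐ g (c ∷ cs) g≡ = cong₂ _∷_ (g≡ 0 (s≤s z≤n)) (applyUpTo-length≡⇐ (g ∘ suc) cs (λ y y< → g≡ (suc y) (s≤s y<)))

map-oneTo-length≡⇒ : ∀ (f : ℕ → ℕ) m → map f (oneTo (length m)) ≡ m → ∀ y → y < length m → f (suc y) ≡ entry m y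
map-oneTo-length≡⇒ f m eq = applyUpTo-length≡⇒ (f ∘ suc) m (trans (sym (map-oneTo f (length m))) eq)

map-oneTo-length≡⇐ : ∀ (f : ℕ → ℕ) m → (∀ y → y < length m → f (suc y) ≡ entry m y) → map f (oneTo (length m)) ≡ m
map-oneTo-length≡⇐ f m f≡ = trans (map-oneTo f (length m)) (applyUpTo-length≡⇐ (f ∘ suc) m f≡)

Content : List ℕ → List ℕ → Set
Content m xs = ∀ y → y < length m → occurrences (suc y) xs ≡ entry m y

length-ones : ∀ n → length (ones n) ≡ n
length-ones zero = refl
length-ones (suc n) = cong suc (length-ones n)

entry-ones : ∀ n y → y < n → entry (ones n) y ≡ 1
entry-ones (suc n) zero _ = refl
entry-ones (suc n) (suc y) (s≤s y<n) = entry-ones n y y<n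

-- Blocks are counted from 0: block y of m is the interval (blockStart m y, blockEnd m y] of positions.
blockStart : List ℕ → ℕ → ℕ
blockStart m y = sum (take y m)

blockEnd : List ℕ → ℕ → ℕ
blockEnd m y = blockStart m y + entry m y

InBlock : List ℕ → ℕ → ℕ → Set
InBlock m y L = blockStart m y < L × L ≤ blockEnd m y

blockOf : List ℕ → ℕ → ℕ
blockOf [] L = 0
blockOf (c ∷ cs) L with L ≤? c
... | yes _ = 0
... | no _ = suc (blockOf cs (L ∸ c))

blockEnd≡blockStart-suc : ∀ m y → blockEnd m y ≡ blockStart m (suc y)
blockEnd≡blockStart-suc [] zero = refl
blockEnd≡blockStart-suc [] (suc y) = refl
blockEnd≡blockStart-suc (c ∷ cs) zero = sym (+-identityʳ c)
blockEnd≡blockStart-suc (c ∷ cs) (suc y) = trans (+-assoc c (blockStart cs y) (entry cs y)) (cong (c +_) (blockEnd≡blockStart-suc cs y))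

blockStart-mono : ∀ m {y z} → y ≤ z → blockStart m y ≤ blockStart m z
blockStart-mono [] {zero} _ = z≤n
blockStart-mono [] {suc y} _ = z≤n
blockStart-mono (c ∷ cs) {zero} _ = z≤n
blockStart-mono (c ∷ cs) {suc y} {suc z} (s≤s y≤z) = +-monoʳ-≤ c (blockStart-mono cs y≤z)

blockEnd≤blockStart : ∀ m {y z} → y < z → blockEnd m y ≤ blockStart m z
blockEnd≤blockStart m {y} y<z = subst (_≤ _) (sym (blockEnd≡blockStart-suc m y)) (blockStart-mono m y<z)

blockEnd≤sum : ∀ m y → blockEnd m y ≤ sum m
blockEnd≤sum m y = subst (_≤ sum m) (sym (blockEnd≡blockStart-suc m y)) (take-sum m (suc y))
  where
  take-sum : ∀ m y → sum (take y m) ≤ sum m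
  take-sum [] zero = z≤n
  take-sum [] (suc y) = z≤n
  take-sum (c ∷ cs) zero = z≤n
  take-sum (c ∷ cs) (suc y) = +-monoʳ-≤ c (take-sum cs y)

InBlock-∷⁺ : ∀ {c cs y L} → c < L → InBlock cs y (L ∸ c) → InBlock (c ∷ cs) (suc y) L
InBlock-∷⁺ {c} {cs} {y} {L} c<L (lo , hi) =
  subst (c + blockStart cs y <_) c+[L∸c]≡L (+-monoʳ-< c lo) ,
  subst₂ _≤_ c+[L∸c]≡L (sym (+-assoc c (blockStart cs y) (entry cs y))) (+-monoʳ-≤ c hi)
  where c+[L∸c]≡L = m+[n∸m]≡n (<⇒≤ c<L)

InBlock-∷⁻ : ∀ {c cs y L} → InBlock (c ∷ cs) (suc y) L → c < L × InBlock cs y (L ∸ c)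
InBlock-∷⁻ {c} {cs} {y} {L} (lo , hi) =
  c<L ,
  +-cancelˡ-< c _ _ (subst (c + blockStart cs y <_) (sym c+[L∸c]≡L) lo) ,
  +-cancelˡ-≤ c _ _ (subst₂ _≤_ (sym c+[L∸c]≡L) (+-assoc c (blockStart cs y) (entry cs y)) hi)
  where
  c<L = ≤-<-trans (m≤m+n c (blockStart cs y)) lo
  c+[L∸c]≡L = m+[n∸m]≡n (<⇒≤ c<L)

blockOf-spec : ∀ m {L} → InRange (sum m) L → blockOf m L < length m × InBlock m (blockOf m L) L
blockOf-spec [] (s≤s z≤n , ())
blockOf-spec (c ∷ cs) {L} (1≤L , L≤) with L ≤? c
... | yes L≤c = s≤s z≤n , 1≤L , L≤c
... | no L≰c =
  let c<L = ≰⇒> L≰c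
      (b< , inBlock) = blockOf-spec cs (m<n⇒0<n∸m c<L , subst (L ∸ c ≤_) (m+n∸m≡n c (sum cs)) (∸-monoˡ-≤ c L≤))
  in s≤s b< , InBlock-∷⁺ {c} {cs} c<L inBlock

blockOf-≡ : ∀ m {y L} → y < length m → InBlock m y L → blockOf m L ≡ y
blockOf-≡ (c ∷ cs) {zero} {L} _ (_ , L≤c) with L ≤? c
... | yes _ = refl
... | no L≰c = ⊥-elim (L≰c L≤c)
blockOf-≡ (c ∷ cs) {suc y} {L} (s≤s y<) inBlock with InBlock-∷⁻ {c} {cs} inBlock | L ≤? c
... | c<L , _ | yes L≤c = ⊥-elim (<⇒≱ c<L L≤c)
... | _ , inBlock′ | no _ = cong suc (blockOf-≡ cs y< inBlock′)

blockOf-mono : ∀ m {L L′} → 1 ≤ L → L ≤ L′ → L′ ≤ sum m → blockOf m L ≤ blockOf m L′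
blockOf-mono m {L} {L′} 1≤L L≤L′ L′≤ with blockOf m L ≤? blockOf m L′
... | yes ≤′ = ≤′
... | no ≰′ =
  let (_ , lo , _) = blockOf-spec m (1≤L , ≤-trans L≤L′ L′≤)
      (_ , _ , hi′) = blockOf-spec m (≤-trans 1≤L L≤L′ , L′≤)
  in ⊥-elim (<⇒≱ (≤-<-trans (≤-trans hi′ (blockEnd≤blockStart m (≰⇒> ≰′))) lo) L≤L′)

-- letter m L is the L-th letter of x₁^{m₁}…x_k^{m_k} written out in increasing order.
letter : List ℕ → ℕ → ℕ
letter m L = suc (blockOf m L)

sortedWord : List ℕ → List ℕ
sortedWord m = map (letter m) (oneTo (sum m))

letter-inRange : ∀ m {L} → InRange (sum m) L → InRange (length m) (letter m L)
letter-inRange m inRange = s≤s z≤n , proj₁ (blockOf-spec m inRange)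

letter-mono : ∀ m {L L′} → 1 ≤ L → L ≤ L′ → L′ ≤ sum m → letter m L ≤ letter m L′
letter-mono m 1≤L L≤L′ L′≤ = s≤s (blockOf-mono m 1≤L L≤L′ L′≤)

letter≡⇒InBlock : ∀ m {y L} → InRange (sum m) L → letter m L ≡ suc y → InBlock m y L
letter≡⇒InBlock m inRange refl = proj₂ (blockOf-spec m inRange)

InBlock⇒letter≡ : ∀ m {y L} → y < length m → InBlock m y L → letter m L ≡ suc y
InBlock⇒letter≡ m y< inBlock = cong suc (blockOf-≡ m y< inBlock)

InBlock⇒inRange : ∀ m {y L} → InBlock m y L → InRange (sum m) L
InBlock⇒inRange m {y} (lo , hi) = ≤-trans (s≤s z≤n) lo , ≤-trans hi (blockEnd≤sum m y)

occurrences-letter : ∀ m {xs y c} → Unique xs → All (InRange (sum m)) xs → y < length m → c ≤ entry m y →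
  (∀ {L} → InBlock m y L → L ∈ xs ⇔ L ≤ blockStart m y + c) →
  occurrences (suc y) (map (letter m) xs) ≡ c
occurrences-letter m {xs} {y} {c} uxs inRange y< c≤ meets =
  trans (occurrences-map (letter m) (suc y) xs)
    (trans (length-≡-of-same-elements (Unique.filter⁺ (λ z → suc y ≟ letter m z) uxs) (interval-unique _ c) to from)
      (length-interval _ c))
  where
  to : ∀ {L} → L ∈ filter (λ z → suc y ≟ letter m z) xs → L ∈ interval (blockStart m y) c
  to L∈ with ∈-filter⁻ (λ z → suc y ≟ letter m z) L∈
  ... | L∈xs , y+1≡ = let inBlock = letter≡⇒InBlock m (All.lookup inRange L∈xs) (sym y+1≡)
                      in ∈-interval⁺ (proj₁ inBlock) (Equivalence.to (meets inBlock) L∈xs)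
  from : ∀ {L} → L ∈ interval (blockStart m y) c → L ∈ filter (λ z → suc y ≟ letter m z) xs
  from L∈ with ∈-interval⁻ L∈
  ... | lo , hi = let inBlock = lo , ≤-trans hi (+-monoʳ-≤ (blockStart m y) c≤)
                  in ∈-filter⁺ (λ z → suc y ≟ letter m z) (Equivalence.from (meets inBlock) hi) (sym (InBlock⇒letter≡ m y< inBlock))

occurrences-letter-all : ∀ m {xs} → Unique xs → All (InRange (sum m)) xs → (∀ {L} → InRange (sum m) L → L ∈ xs) →
  Content m (map (letter m) xs)
occurrences-letter-all m uxs inRange complete y y< =
  occurrences-letter m uxs inRange y< ≤-refl (λ inBlock → mk⇔ (λ _ → proj₂ inBlock) (λ _ → complete (InBlock⇒inRange m inBlock)))

sortedWord-sorted : ∀ m → Linked _≤_ (sortedWord m)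
sortedWord-sorted m = subst (Linked _≤_) (sym (map-oneTo (letter m) (sum m)))
  (applyUpTo⁺₁ (letter m ∘ suc) (sum m) (λ i+1< → letter-mono m (s≤s z≤n) (n≤1+n _) i+1<))

sortedWord-inRange : ∀ m → All (InRange (length m)) (sortedWord m)
sortedWord-inRange m = All.map⁺ (All.tabulate (λ L∈ → letter-inRange m (∈-oneTo⁻ L∈)))

length-sortedWord : ∀ m → length (sortedWord m) ≡ sum m
length-sortedWord m = trans (length-map (letter m) (oneTo (sum m))) (length-oneTo (sum m))

content-sortedWord : ∀ m → map (λ v → occurrences v (sortedWord m)) (oneTo (length m)) ≡ m
content-sortedWord m = map-oneTo-length≡⇐ _ m
  (occurrences-letter-all m (oneTo-unique (sum m)) (All.tabulate ∈-oneTo⁻) ∈-oneTo⁺)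

sorted-content⇒sortedWord : ∀ m {w} → Linked _≤_ w → All (InRange (length m)) w →
  map (λ v → occurrences v w) (oneTo (length m)) ≡ m → w ≡ sortedWord m
sorted-content⇒sortedWord m {w} sorted inRange content =
  sorted-≡ w (sortedWord m) sorted (sortedWord-sorted m) same
  where
  same : ∀ v → occurrences v w ≡ occurrences v (sortedWord m)
  same zero = trans (occurrences-outside inRange (λ ())) (sym (occurrences-outside (sortedWord-inRange m) (λ ())))
  same (suc y) with y <? length m
  ... | yes y< = trans (map-oneTo-length≡⇒ _ m content y y<) (sym (map-oneTo-length≡⇒ _ m (content-sortedWord m) y y<))
  ... | no y≮ = trans (occurrences-outside inRange (y≮ ∘ proj₂)) (sym (occurrences-outside (sortedWord-inRange m) (y≮ ∘ proj₂)))

-- Coefficients of fundamental quasisymmetric functions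

indicator : ∀ {P : Set} → Dec P → ℕ
indicator (yes _) = 1
indicator (no _) = 0

indicator-yes : ∀ {P : Set} (d : Dec P) → P → indicator d ≡ 1
indicator-yes (yes _) _ = refl
indicator-yes (no ¬p) p = ⊥-elim (¬p p)

indicator-no : ∀ {P : Set} (d : Dec P) → ¬ P → indicator d ≡ 0
indicator-no (yes p) ¬p = ⊥-elim (¬p p)
indicator-no (no _) _ = refl

indicator-⇔ : ∀ {P Q : Set} (p? : Dec P) (q? : Dec Q) → P ⇔ Q → indicator p? ≡ indicator q?
indicator-⇔ p? (yes q) P⇔Q = indicator-yes p? (Equivalence.from P⇔Q q)
indicator-⇔ p? (no ¬q) P⇔Q = indicator-no p? (¬q ∘ Equivalence.to P⇔Q)

sum-map-indicator : ∀ {A : Set} {P : A → Set} (P? : Decidable P) xs →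
  sum (map (λ x → indicator (P? x)) xs) ≡ length (filter P? xs)
sum-map-indicator P? [] = refl
sum-map-indicator P? (x ∷ xs) with P? x
... | yes _ = cong suc (sum-map-indicator P? xs)
... | no _ = sum-map-indicator P? xs

admissible⇒sorted : ∀ s j w → Admissible s j w → Linked _≤_ w
admissible⇒sorted s j [] _ = Linked.[]
admissible⇒sorted s j (x ∷ []) _ = [-]
admissible⇒sorted s j (x ∷ y ∷ zs) (x≤y , _ , adm) = x≤y Linked.∷ admissible⇒sorted s (suc j) (y ∷ zs) adm

AdmitsSortedWord : List ℕ → ℕ → List ℕ → Set
AdmitsSortedWord s N m = N ≡ sum m × Admissible s 1 (sortedWord m)

admitsSortedWord? : ∀ s N m → Dec (AdmitsSortedWord s N m)
admitsSortedWord? s N m = (N ≟ sum m) ×-dec admissible? s 1 (sortedWord m)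

coeffF-≡ : ∀ β m → coeffF β m ≡ indicator (admitsSortedWord? (setOf β) (sum β) m)
coeffF-≡ β m =
  trans (length-filter-≡-by-inverses (fTerm? β m) (λ _ → admitsSortedWord? (setOf β) (sum β) m)
           (wordsOf (length m) (sum β)) (sortedWord m ∷ []) (wordsOf-unique (length m) (sum β)) ([] ∷ [])
           (λ w → w) (λ w → w) term⇒sortedWord sortedWord⇒term)
        (filter-singleton (admitsSortedWord? (setOf β) (sum β) m))
  where
  term⇒sortedWord : ∀ w → w ∈ wordsOf (length m) (sum β) → FTerm β m w →
    (w ∈ sortedWord m ∷ [] × AdmitsSortedWord (setOf β) (sum β) m) × w ≡ w
  term⇒sortedWord w w∈ (adm , content) =
    let (len , inRange) = ∈-wordsOf⁻ (sum β) w∈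
        w≡ = sorted-content⇒sortedWord m (admissible⇒sorted _ 1 w adm) inRange content
    in (here w≡ , trans (sym len) (trans (cong length w≡) (length-sortedWord m)) , subst (Admissible (setOf β) 1) w≡ adm) , refl
  sortedWord⇒term : ∀ w → w ∈ sortedWord m ∷ [] → AdmitsSortedWord (setOf β) (sum β) m →
    (w ∈ wordsOf (length m) (sum β) × FTerm β m w) × w ≡ w
  sortedWord⇒term w (here refl) (N≡ , adm) =
    (subst (λ N → w ∈ wordsOf (length m) N) (trans (length-sortedWord m) (sym N≡)) (∈-wordsOf⁺ w (sortedWord-inRange m)) ,
     adm , content-sortedWord m) , refl
  filter-singleton : ∀ {X : Set} (d : Dec X) → length (filter (λ _ → d) (sortedWord m ∷ [])) ≡ indicator d
  filter-singleton (yes _) = refl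
  filter-singleton (no _) = refl

∸-split : ∀ {p s n} → p ≤ s → s ≤ n → (s ∸ p) + (n ∸ s) ≡ n ∸ p
∸-split {p} {s} {n} p≤s s≤n = begin
  (s ∸ p) + (n ∸ s)  ≡⟨ +-comm (s ∸ p) (n ∸ s) ⟩
  (n ∸ s) + (s ∸ p)  ≡⟨ sym (+-∸-assoc (n ∸ s) p≤s) ⟩
  (n ∸ s + s) ∸ p    ≡⟨ cong (_∸ p) (m∸n+n≡m s≤n) ⟩
  n ∸ p              ∎
  where open ≡-Reasoning

sum-compAux : ∀ n p D → Linked _≤_ (p ∷ D) → All (_≤ n) D → p ≤ n → sum (compAux n p D) ≡ n ∸ p
sum-compAux n p [] _ _ _ = +-identityʳ (n ∸ p)
sum-compAux n p (s ∷ D) sorted (s≤n ∷ D≤n) p≤n =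
  trans (cong ((s ∸ p) +_) (sum-compAux n s D (Linked.tail sorted) D≤n s≤n)) (∸-split (Linked.head sorted) s≤n)

setAux-compAux : ∀ n p D → Linked _≤_ (p ∷ D) → setAux p (compAux n p D) ≡ D
setAux-compAux n p [] _ = refl
setAux-compAux n p (s ∷ []) sorted = cong (_∷ []) (m+[n∸m]≡n (Linked.head sorted))
setAux-compAux n p (s ∷ t ∷ D) sorted =
  cong₂ _∷_ p+[s∸p]≡s (trans (cong (λ a → setAux a (compAux n s (t ∷ D))) p+[s∸p]≡s) (setAux-compAux n s (t ∷ D) (Linked.tail sorted)))
  where p+[s∸p]≡s = m+[n∸m]≡n (Linked.head sorted)

0∷oneTo-sorted : ∀ N → Linked _≤_ (0 ∷ oneTo N)
0∷oneTo-sorted N = subst (λ xs → Linked _≤_ (0 ∷ xs)) (sym (map-applyUpTo (λ i → i) suc N))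
  (applyUpTo⁺₁ (λ i → i) (suc N) (λ _ → n≤1+n _))

0∷descents-sorted : ∀ n S → Linked _≤_ (0 ∷ descents n S)
0∷descents-sorted n S = ∷-filter⁺ (λ i → rowOf (suc i) S ≤? rowOf i S) ≤-trans (0∷oneTo-sorted (n ∸ 1))

∈-descents⁺ : ∀ n S {j} → InRange (n ∸ 1) j → rowOf (suc j) S ≤ rowOf j S → j ∈ descents n S
∈-descents⁺ n S inRange below = ∈-filter⁺ (λ i → rowOf (suc i) S ≤? rowOf i S) (∈-oneTo⁺ inRange) below

∈-descents⁻ : ∀ n S {j} → j ∈ descents n S → InRange (n ∸ 1) j × rowOf (suc j) S ≤ rowOf j S
∈-descents⁻ n S j∈ = let (j∈oneTo , below) = ∈-filter⁻ (λ i → rowOf (suc i) S ≤? rowOf i S) j∈ in ∈-oneTo⁻ j∈oneTo , below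

descents-bounded : ∀ n S → All (_≤ n) (descents n S)
descents-bounded n S = All.tabulate λ j∈ → ≤-trans (proj₂ (proj₁ (∈-descents⁻ n S j∈))) (m∸n≤m n 1)

coeffF-comp-descents : ∀ m n S → coeffF (comp n (descents n S)) m ≡ indicator (admitsSortedWord? (descents n S) n m)
coeffF-comp-descents m n S =
  trans (coeffF-≡ (comp n D) m)
    (cong₂ (λ s N → indicator (admitsSortedWord? s N m))
      (setAux-compAux n 0 D (0∷descents-sorted n S))
      (sum-compAux n 0 D (0∷descents-sorted n S) (descents-bounded n S) z≤n))
  where D = descents n S

-- Compatibility of a standard tableau with the blocks of m

Compatible : List ℕ → Tableau → Set
Compatible m S = ∀ j → 1 ≤ j → suc j ≤ sum m → blockOf m j ≡ blockOf m (suc j) → rowOf j S < rowOf (suc j) S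

admissible-applyUpTo⁺ : ∀ s a (g : ℕ → ℕ) N →
  (∀ i → suc i < N → g i ≤ g (suc i) × (g i ≡ g (suc i) → a + i ∉ s)) → Admissible s a (applyUpTo g N)
admissible-applyUpTo⁺ s a g zero _ = _
admissible-applyUpTo⁺ s a g (suc zero) _ = _
admissible-applyUpTo⁺ s a g (suc (suc N)) ok =
  let (g0≤g1 , g0≡g1⇒) = ok 0 (s≤s (s≤s z≤n)) in
  g0≤g1 , subst (λ j → g 0 ≡ g 1 → j ∉ s) (+-identityʳ a) g0≡g1⇒ ,
  admissible-applyUpTo⁺ s (suc a) (g ∘ suc) (suc N)
    (λ i i+1< → let (≤′ , ≡⇒) = ok (suc i) (s≤s i+1<) in ≤′ , subst (λ j → g (suc i) ≡ g (suc (suc i)) → j ∉ s) (+-suc a i) ≡⇒)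

admissible-applyUpTo⁻ : ∀ s a (g : ℕ → ℕ) N → Admissible s a (applyUpTo g N) →
  ∀ i → suc i < N → g i ≡ g (suc i) → a + i ∉ s
admissible-applyUpTo⁻ s a g (suc zero) _ zero (s≤s ())
admissible-applyUpTo⁻ s a g (suc (suc N)) (_ , ≡⇒∉ , _) zero _ g0≡g1 = subst (_∉ s) (sym (+-identityʳ a)) (≡⇒∉ g0≡g1)
admissible-applyUpTo⁻ s a g (suc (suc N)) (_ , _ , adm) (suc i) (s≤s i+1<) ≡′ =
  subst (_∉ s) (sym (+-suc a i)) (admissible-applyUpTo⁻ s (suc a) (g ∘ suc) (suc N) adm i i+1< ≡′)

compatible⇒admissible : ∀ m S → Compatible m S → Admissible (descents (sum m) S) 1 (sortedWord m)
compatible⇒admissible m S compatible = subst (Admissible (descents (sum m) S) 1) (sym (map-oneTo (letter m) (sum m)))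
  (admissible-applyUpTo⁺ _ 1 (letter m ∘ suc) (sum m) λ i i+1< →
    letter-mono m (s≤s z≤n) (n≤1+n _) i+1< ,
    λ ≡′ i+1∈ → <⇒≱ (compatible (suc i) (s≤s z≤n) i+1< (suc-injective ≡′)) (proj₂ (∈-descents⁻ (sum m) S i+1∈)))

admissible⇒compatible : ∀ m S → Admissible (descents (sum m) S) 1 (sortedWord m) → Compatible m S
admissible⇒compatible m S adm (suc i) _ i+2≤ ≡′ with rowOf (suc (suc i)) S ≤? rowOf (suc i) S
... | no ≰′ = ≰⇒> ≰′
... | yes below = ⊥-elim (admissible-applyUpTo⁻ _ 1 (letter m ∘ suc) (sum m)
  (subst (Admissible (descents (sum m) S) 1) (map-oneTo (letter m) (sum m)) adm) i i+2≤ (cong suc ≡′)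
  (∈-descents⁺ (sum m) S (s≤s z≤n , ∸-monoˡ-≤ 1 i+2≤) below))

rowOf-∈ : ∀ {v r} rs → v ∈ r → rowOf v (r ∷ rs) ≡ 0
rowOf-∈ {v} {r} rs v∈ = cong (λ b → if b then 0 else suc (rowOf v rs)) (dec-true (v ∈? r) v∈)

rowOf-∉ : ∀ {v r} rs → v ∉ r → rowOf v (r ∷ rs) ≡ suc (rowOf v rs)
rowOf-∉ {v} {r} rs v∉ = cong (λ b → if b then 0 else suc (rowOf v rs)) (dec-false (v ∈? r) v∉)

rowOf-++-∈ : ∀ {v} Pre rs → v ∈ concat Pre → rowOf v (Pre ++ rs) < length Pre
rowOf-++-∈ {v} (r ∷ Pre) rs v∈ with v ∈? r
... | yes _ = s≤s z≤n
... | no v∉r with ∈-++⁻ r v∈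
...   | inj₁ v∈r = ⊥-elim (v∉r v∈r)
...   | inj₂ v∈Pre = s≤s (rowOf-++-∈ Pre rs v∈Pre)

rowOf-++-∉ : ∀ {v} Pre rs → v ∉ concat Pre → rowOf v (Pre ++ rs) ≡ length Pre + rowOf v rs
rowOf-++-∉ [] rs _ = refl
rowOf-++-∉ (r ∷ Pre) rs v∉ = trans (rowOf-∉ {r = r} (Pre ++ rs) (v∉ ∘ ∈-++⁺ˡ)) (cong suc (rowOf-++-∉ Pre rs (v∉ ∘ ∈-++⁺ʳ r)))

∈-concat⇔rowOf-< : ∀ Pre rs {v} → v ∈ concat Pre ⇔ rowOf v (Pre ++ rs) < length Pre
∈-concat⇔rowOf-< Pre rs {v} = mk⇔ (rowOf-++-∈ Pre rs) from
  where
  from : rowOf v (Pre ++ rs) < length Pre → v ∈ concat Pre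
  from below with v ∈? concat Pre
  ... | yes v∈ = v∈
  ... | no v∉ = ⊥-elim (<⇒≱ below (subst (length Pre ≤_) (sym (rowOf-++-∉ Pre rs v∉)) (m≤m+n _ _)))

rowOf-same-row : ∀ S {r a b} → Unique (concat S) → r ∈ S → a ∈ r → b ∈ r → rowOf a S ≡ rowOf b S
rowOf-same-row (r ∷ S) _ (here refl) a∈ b∈ = trans (rowOf-∈ S a∈) (sym (rowOf-∈ S b∈))
rowOf-same-row (r₀ ∷ S) u (there r∈) a∈ b∈ =
  trans (rowOf-∉ S (not-below a∈)) (trans (cong suc (rowOf-same-row S (++-unique⇒uniqueʳ r₀ u) r∈ a∈ b∈)) (sym (rowOf-∉ S (not-below b∈))))
  where
  not-below : ∀ {v} → v ∈ _ → v ∉ r₀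
  not-below v∈ v∈r₀ = ++-unique⇒disjoint r₀ u v∈r₀ (∈-concat⁺′ v∈ r∈)

length-concat : ∀ {A : Set} (xss : List (List A)) → length (concat xss) ≡ sum (map length xss)
length-concat [] = refl
length-concat (xs ∷ xss) = trans (length-++ xs) (cong (length xs +_) (length-concat xss))

firstColumn-map : ∀ (f : ℕ → ℕ) U → firstColumn (map (map f) U) ≡ map f (firstColumn U)
firstColumn-map f [] = refl
firstColumn-map f ([] ∷ U) = firstColumn-map f U
firstColumn-map f ((x ∷ r) ∷ U) = cong (f x ∷_) (firstColumn-map f U)

firstColumn-all : ∀ {P : ℕ → Set} U → All (All P) U → All P (firstColumn U)
firstColumn-all [] [] = []
firstColumn-all ([] ∷ U) (_ ∷ ps) = firstColumn-all U ps
firstColumn-all ((x ∷ r) ∷ U) ((px ∷ _) ∷ ps) = px ∷ firstColumn-all U ps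

map⁺-Linked : ∀ {R R′ : ℕ → ℕ → Set} {P : ℕ → Set} (f : ℕ → ℕ) {xs} → All P xs → Linked R xs →
  (∀ {a b} → P a → P b → R a b → R′ (f a) (f b)) → Linked R′ (map f xs)
map⁺-Linked f [] Linked.[] _ = Linked.[]
map⁺-Linked f (_ ∷ []) [-] _ = [-]
map⁺-Linked f (pa ∷ pb ∷ ps) (ab Linked.∷ l) mono = mono pa pb ab Linked.∷ map⁺-Linked f (pb ∷ ps) l mono

-- Standardization

StrictRows : ℕ → Tableau → Set
StrictRows k U = All (λ r → All (InRange k) r × Linked _<_ r) U

destandardize : List ℕ → Tableau → Tableau
destandardize m = map (map (letter m))

destandardize-shape : ∀ m S → map length (destandardize m S) ≡ map length S
destandardize-shape m [] = refl
destandardize-shape m (r ∷ S) = cong₂ _∷_ (length-map (letter m) r) (destandardize-shape m S)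

module Standardization (m : List ℕ) where

  position : ℕ → ℕ → ℕ
  position y c = suc (blockStart m y + c)

  position-InBlock : ∀ {y c} → c < entry m y → InBlock m y (position y c)
  position-InBlock {y} {c} c< = s≤s (m≤m+n _ c) , +-monoʳ-< (blockStart m y) c<

  letter-position : ∀ {y c} → y < length m → c < entry m y → letter m (position y c) ≡ suc y
  letter-position y< c< = InBlock⇒letter≡ m y< (position-InBlock c<)

  position-< : ∀ {y y′ c c′} → c < entry m y → y < y′ → position y c < position y′ c′
  position-< {y} c< y<y′ =
    s≤s (≤-trans (+-monoʳ-< (blockStart m y) c<) (≤-trans (blockEnd≤blockStart m y<y′) (m≤m+n _ _)))

  position≤blockEnd⇒ : ∀ {y c} → position y c ≤ blockEnd m y → c < entry m y
  position≤blockEnd⇒ {y} {c} ≤end = +-cancelˡ-≤ (blockStart m y) (suc c) (entry m y) (subst (_≤ blockEnd m y) (sym (+-suc _ c)) ≤end)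

  InBlock⇒position : ∀ {y L} → InBlock m y L → Σ[ c ∈ ℕ ] c < entry m y × L ≡ position y c
  InBlock⇒position {y} {L} (lo , hi) = c , position≤blockEnd⇒ (subst (_≤ blockEnd m y) L≡ hi) , L≡
    where
    c = L ∸ suc (blockStart m y)
    L≡ : L ≡ position y c
    L≡ = sym (m+[n∸m]≡n lo)

  -- B lists the entries of the rows below, so the copy of y + 1 with c copies below it becomes position y c.
  label : List ℕ → ℕ → ℕ
  label B zero = 0
  label B (suc y) = position y (occurrences (suc y) B)

  standardizeAbove : List ℕ → Tableau → Tableau
  standardizeAbove B [] = []
  standardizeAbove B (r ∷ rs) = map (label B) r ∷ standardizeAbove (B ++ r) rs

  standardize : Tableau → Tableau
  standardize = standardizeAbove []

  Content-next : ∀ B r rs → Content m (B ++ concat (r ∷ rs)) → Content m ((B ++ r) ++ concat rs)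
  Content-next B r rs = subst (Content m) (sym (++-assoc B r (concat rs)))

  Content-done : ∀ B {y} → Content m (B ++ concat []) → y < length m → occurrences (suc y) B ≡ entry m y
  Content-done B {y} content y< = trans (cong (occurrences (suc y)) (sym (++-identityʳ B))) (content y y<)

  count-below : ∀ B r rs {y} → Content m (B ++ concat (r ∷ rs)) → y < length m → suc y ∈ r →
    occurrences (suc y) B < entry m y
  count-below B r rs {y} content y< y+1∈ =
    subst (occurrences (suc y) B <_) (trans (sym (occurrences-++ (suc y) B (r ++ concat rs))) (content y y<))
      (m<m+n _ (occurrences-∈ (r ++ concat rs) (∈-++⁺ˡ y+1∈)))

  standardizeAbove-shape : ∀ B rs → map length (standardizeAbove B rs) ≡ map length rs
  standardizeAbove-shape B [] = refl
  standardizeAbove-shape B (r ∷ rs) = cong₂ _∷_ (length-map (label B) r) (standardizeAbove-shape (B ++ r) rs)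

  standardizeAbove-inRange : ∀ B rs → Content m (B ++ concat rs) → StrictRows (length m) rs →
    All (All (InRange (sum m))) (standardizeAbove B rs)
  standardizeAbove-inRange B [] _ _ = []
  standardizeAbove-inRange B (r ∷ rs) content ((r-inRange , _) ∷ strict) =
    All.map⁺ (All.tabulate λ x∈ → label-inRange x∈ (All.lookup r-inRange x∈))
    ∷ standardizeAbove-inRange (B ++ r) rs (Content-next B r rs content) strict
    where
    label-inRange : ∀ {x} → x ∈ r → InRange (length m) x → InRange (sum m) (label B x)
    label-inRange {suc y} x∈ (_ , y<) = InBlock⇒inRange m (position-InBlock (count-below B r rs content y< x∈))

  standardizeAbove-rows : ∀ B rs → Content m (B ++ concat rs) → StrictRows (length m) rs →
    All (Linked _<_) (standardizeAbove B rs)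
  standardizeAbove-rows B [] _ _ = []
  standardizeAbove-rows B (r ∷ rs) content ((r-inRange , r-strict) ∷ strict) =
    map⁺-Linked (label B) (All.tabulate (λ x∈ → x∈ , All.lookup r-inRange x∈)) r-strict label-<
    ∷ standardizeAbove-rows (B ++ r) rs (Content-next B r rs content) strict
    where
    label-< : ∀ {x x′} → x ∈ r × InRange (length m) x → x′ ∈ r × InRange (length m) x′ → x < x′ → label B x < label B x′
    label-< {suc y} {suc y′} (x∈ , _ , y<) _ (s≤s y<y′) = position-< (count-below B r rs content y< x∈) y<y′

  destandardize-standardizeAbove : ∀ B rs → Content m (B ++ concat rs) → StrictRows (length m) rs →
    destandardize m (standardizeAbove B rs) ≡ rs
  destandardize-standardizeAbove B [] _ _ = refl
  destandardize-standardizeAbove B (r ∷ rs) content ((r-inRange , _) ∷ strict) =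
    cong₂ _∷_ (trans (sym (map-∘ r)) (map-id-local (All.tabulate λ x∈ → letter-label x∈ (All.lookup r-inRange x∈))))
      (destandardize-standardizeAbove (B ++ r) rs (Content-next B r rs content) strict)
    where
    letter-label : ∀ {x} → x ∈ r → InRange (length m) x → letter m (label B x) ≡ x
    letter-label {suc y} x∈ (_ , y<) = letter-position y< (count-below B r rs content y< x∈)

  label-≤ : ∀ B r rs {x x′} → Content m (B ++ concat ((x ∷ r) ∷ rs)) → InRange (length m) x → x ≤ x′ →
    label B x ≤ label (B ++ x ∷ r) x′
  label-≤ B r rs {suc y} {suc y′} content (_ , y<) x≤x′ with y ≟ y′
  ... | yes refl = s≤s (+-monoʳ-≤ (blockStart m y)
    (subst (occurrences (suc y) B ≤_) (sym (occurrences-++ (suc y) B (suc y ∷ r))) (m≤m+n _ _)))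
  ... | no y≢y′ = <⇒≤ (position-< (count-below B (suc y ∷ r) rs content y< (here refl)) (≤∧≢⇒< (≤-pred x≤x′) y≢y′))

  standardizeAbove-firstColumn : ∀ B rs → Content m (B ++ concat rs) → StrictRows (length m) rs →
    All (λ r → 0 < length r) rs → Linked _≤_ (firstColumn rs) → Linked _≤_ (firstColumn (standardizeAbove B rs))
  standardizeAbove-firstColumn B [] _ _ _ _ = Linked.[]
  standardizeAbove-firstColumn B ([] ∷ rs) _ _ (() ∷ _) _
  standardizeAbove-firstColumn B ((x ∷ r) ∷ []) _ _ _ _ = [-]
  standardizeAbove-firstColumn B ((x ∷ r) ∷ [] ∷ rs) _ _ (_ ∷ () ∷ _) _
  standardizeAbove-firstColumn B ((x ∷ r) ∷ (x′ ∷ r′) ∷ rs) content (((x-inRange ∷ _) , _) ∷ strict) (_ ∷ nonempty) (x≤x′ Linked.∷ sorted) =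
    label-≤ B r ((x′ ∷ r′) ∷ rs) content x-inRange x≤x′
    Linked.∷ standardizeAbove-firstColumn (B ++ x ∷ r) ((x′ ∷ r′) ∷ rs) (Content-next B (x ∷ r) ((x′ ∷ r′) ∷ rs) content) strict nonempty sorted

  labels-∈⁺ : ∀ B r {y c} → suc y ∈ r → occurrences (suc y) B ≡ c → position y c ∈ map (label B) r
  labels-∈⁺ B r y+1∈ refl = ∈-map⁺ (label B) y+1∈

  labels-∈⁻ : ∀ B r rs {y c} → Content m (B ++ concat (r ∷ rs)) → All (InRange (length m)) r →
    y < length m → c < entry m y → position y c ∈ map (label B) r → suc y ∈ r × occurrences (suc y) B ≡ c
  labels-∈⁻ B r rs {y} {c} content r-inRange y< c< L∈ with ∈-map⁻ (label B) L∈
  ... | x , x∈ , L≡ = same-letter x x∈ (All.lookup r-inRange x∈) L≡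
    where
    same-letter : ∀ x → x ∈ r → InRange (length m) x → position y c ≡ label B x → suc y ∈ r × occurrences (suc y) B ≡ c
    same-letter (suc y′) x∈ (_ , y′<) L≡
      with trans (sym (letter-position y< c<)) (trans (cong (letter m) L≡) (letter-position y′< (count-below B r rs content y′< x∈)))
    ... | refl = x∈ , sym (+-cancelˡ-≡ (blockStart m y) _ _ (suc-injective L≡))

  -- One row of labels: position y c is in it exactly when the row holds the c-th copy of y + 1.
  occurrences-labels : ∀ B r rs {y c} → y < length m → c < entry m y →
    Content m (B ++ concat (r ∷ rs)) → StrictRows (length m) (r ∷ rs) →
    occurrences (position y c) (map (label B) r) + indicator (occurrences (suc y) B + occurrences (suc y) r ≤? c)
      ≡ indicator (occurrences (suc y) B ≤? c)
  occurrences-labels B r rs {y} {c} y< c< content strict@((r-inRange , r-strict) ∷ _) = split (b ≟ c) (suc y ∈? r)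
    where
    L = position y c
    b = occurrences (suc y) B
    L∉ : ¬ (suc y ∈ r × b ≡ c) → L ∉ map (label B) r
    L∉ ¬both L∈ = ¬both (labels-∈⁻ B r rs content r-inRange y< c< L∈)
    split : Dec (b ≡ c) → Dec (suc y ∈ r) →
      occurrences L (map (label B) r) + indicator (b + occurrences (suc y) r ≤? c) ≡ indicator (b ≤? c)
    split (yes b≡c) (yes y+1∈) =
      trans (cong₂ _+_ (occurrences-∈-unique (strict⇒unique (All.head (standardizeAbove-rows B (r ∷ rs) content strict))) (labels-∈⁺ B r y+1∈ b≡c))
                       (indicator-no (_ ≤? c) λ ≤c → <-irrefl refl (subst (_≤ c) b+1≡ ≤c)))
            (sym (indicator-yes (b ≤? c) (≤-reflexive b≡c)))
      where
      b+1≡ : b + occurrences (suc y) r ≡ suc c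
      b+1≡ = trans (cong₂ _+_ b≡c (occurrences-∈-unique (strict⇒unique r-strict) y+1∈)) (+-comm c 1)
    split (yes b≡c) (no y+1∉) =
      trans (cong₂ _+_ (occurrences-∉ _ (L∉ (y+1∉ ∘ proj₁))) (indicator-yes (_ ≤? c) (≤-reflexive b+0≡)))
            (sym (indicator-yes (b ≤? c) (≤-reflexive b≡c)))
      where
      b+0≡ : b + occurrences (suc y) r ≡ c
      b+0≡ = trans (cong (b +_) (occurrences-∉ r y+1∉)) (trans (+-identityʳ b) b≡c)
    split (no b≢c) _ =
      trans (cong (_+ indicator (b + occurrences (suc y) r ≤? c)) (occurrences-∉ (map (label B) r) (L∉ (b≢c ∘ proj₂))))
        (indicator-⇔ (_ ≤? c) (b ≤? c) (mk⇔ (≤-trans (m≤m+n b _)) λ b≤c →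
          ≤-trans (+-monoʳ-≤ b (unique⇒occurrences≤1 (strict⇒unique r-strict) (suc y))) (subst (_≤ c) (+-comm 1 b) (≤∧≢⇒< b≤c b≢c))))

  occurrences-standardizeAbove : ∀ B rs {y c} → y < length m → c < entry m y →
    Content m (B ++ concat rs) → StrictRows (length m) rs →
    occurrences (position y c) (concat (standardizeAbove B rs)) ≡ indicator (occurrences (suc y) B ≤? c)
  occurrences-standardizeAbove B [] {y} {c} y< c< content _ =
    sym (indicator-no (_ ≤? c) (λ b≤c → <⇒≱ c< (subst (_≤ c) (Content-done B content y<) b≤c)))
  occurrences-standardizeAbove B (r ∷ rs) {y} {c} y< c< content strict = begin
    occurrences L (map (label B) r ++ concat rest)
      ≡⟨ occurrences-++ L (map (label B) r) (concat rest) ⟩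
    occurrences L (map (label B) r) + occurrences L (concat rest)
      ≡⟨ cong (occurrences L (map (label B) r) +_)
           (occurrences-standardizeAbove (B ++ r) rs y< c< (Content-next B r rs content) (All.tail strict)) ⟩
    occurrences L (map (label B) r) + indicator (occurrences (suc y) (B ++ r) ≤? c)
      ≡⟨ cong (λ n → occurrences L (map (label B) r) + indicator (n ≤? c)) (occurrences-++ (suc y) B r) ⟩
    occurrences L (map (label B) r) + indicator (occurrences (suc y) B + occurrences (suc y) r ≤? c)
      ≡⟨ occurrences-labels B r rs y< c< content strict ⟩
    indicator (occurrences (suc y) B ≤? c) ∎
    where
    open ≡-Reasoning
    L = position y c
    rest = standardizeAbove (B ++ r) rs

  -- Within a block, labels are handed out row by row from the bottom.
  rowOf-standardizeAbove-< : ∀ B rs {y c} → y < length m → suc c < entry m y →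
    Content m (B ++ concat rs) → StrictRows (length m) rs → occurrences (suc y) B ≤ c →
    rowOf (position y c) (standardizeAbove B rs) < rowOf (position y (suc c)) (standardizeAbove B rs)
  rowOf-standardizeAbove-< B [] {y} {c} y< c+1< content _ b≤c =
    ⊥-elim (<⇒≱ c+1< (≤-trans (≤-reflexive (sym (Content-done B content y<))) (≤-trans b≤c (n≤1+n c))))
  rowOf-standardizeAbove-< B (r ∷ rs) {y} {c} y< c+1< content ((r-inRange , r-strict) ∷ strict) b≤c =
    split (b ≟ c) (suc y ∈? r)
    where
    b = occurrences (suc y) B
    rest = standardizeAbove (B ++ r) rs
    c< = ≤-trans (n≤1+n _) c+1<
    L′∉ : position y (suc c) ∉ map (label B) r
    L′∉ L′∈ = <-irrefl refl (subst (_≤ c) (proj₂ (labels-∈⁻ B r rs content r-inRange y< c+1< L′∈)) b≤c)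
    above : ¬ (suc y ∈ r × b ≡ c) → occurrences (suc y) (B ++ r) ≤ c →
      rowOf (position y c) (map (label B) r ∷ rest) < rowOf (position y (suc c)) (map (label B) r ∷ rest)
    above ¬both ≤c = subst₂ _<_
      (sym (rowOf-∉ rest λ L∈ → ¬both (labels-∈⁻ B r rs content r-inRange y< c< L∈)))
      (sym (rowOf-∉ rest L′∉))
      (s≤s (rowOf-standardizeAbove-< (B ++ r) rs y< c+1< (Content-next B r rs content) strict ≤c))
    b+0≤c : suc y ∉ r → occurrences (suc y) (B ++ r) ≤ c
    b+0≤c y+1∉ = subst (_≤ c) (sym (trans (occurrences-++ (suc y) B r) (trans (cong (b +_) (occurrences-∉ r y+1∉)) (+-identityʳ b)))) b≤c
    split : Dec (b ≡ c) → Dec (suc y ∈ r) →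
      rowOf (position y c) (map (label B) r ∷ rest) < rowOf (position y (suc c)) (map (label B) r ∷ rest)
    split (yes b≡c) (yes y+1∈) = subst₂ _<_ (sym (rowOf-∈ rest (labels-∈⁺ B r y+1∈ b≡c))) (sym (rowOf-∉ rest L′∉)) (s≤s z≤n)
    split _ (no y+1∉) = above (y+1∉ ∘ proj₁) (b+0≤c y+1∉)
    split (no b≢c) (yes y+1∈) = above (b≢c ∘ proj₂) (subst (_≤ c) (sym (b+1≡ y+1∈)) (≤∧≢⇒< b≤c b≢c))
      where
      b+1≡ : suc y ∈ r → occurrences (suc y) (B ++ r) ≡ suc b
      b+1≡ y+1∈ = trans (occurrences-++ (suc y) B r) (trans (cong (b +_) (occurrences-∈-unique (strict⇒unique r-strict) y+1∈)) (+-comm b 1))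

  standardize-compatible : ∀ U → Content m (concat U) → StrictRows (length m) U → Compatible m (standardize U)
  standardize-compatible U content strict j 1≤j j+1≤ same-block =
    subst₂ (λ a b → rowOf a (standardize U) < rowOf b (standardize U)) (sym j≡) (sym (trans (cong suc j≡) (cong suc (sym (+-suc _ c)))))
      (rowOf-standardizeAbove-< [] U y< c+1< content strict z≤n)
    where
    spec = blockOf-spec m (1≤j , ≤-trans (n≤1+n j) j+1≤)
    y = blockOf m j
    y< = proj₁ spec
    c = proj₁ (InBlock⇒position (proj₂ spec))
    j≡ : j ≡ position y c
    j≡ = proj₂ (proj₂ (InBlock⇒position (proj₂ spec)))
    c+1< : suc c < entry m y
    c+1< = position≤blockEnd⇒ (subst (_≤ blockEnd m y) (trans (cong suc j≡) (cong suc (sym (+-suc _ c))))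
      (subst (λ z → suc j ≤ blockEnd m z) (sym same-block) (proj₂ (proj₂ (blockOf-spec m (s≤s z≤n , j+1≤))))))

  occurrences-standardize : ∀ U → Content m (concat U) → StrictRows (length m) U →
    ∀ L → InRange (sum m) L → occurrences L (concat (standardize U)) ≡ 1
  occurrences-standardize U content strict L inRange =
    let (y< , inBlock) = blockOf-spec m inRange ; (c , c< , L≡) = InBlock⇒position inBlock
    in trans (cong (λ z → occurrences z (concat (standardize U))) L≡)
         (trans (occurrences-standardizeAbove [] U y< c< content strict) (indicator-yes (0 ≤? c) z≤n))

-- Destandardization

Compatible⇒rowOf-< : ∀ m S → Compatible m S → ∀ {a b} → 1 ≤ a → a < b → b ≤ sum m →
  blockOf m a ≡ blockOf m b → rowOf a S < rowOf b S
Compatible⇒rowOf-< m S compatible {a} {suc b} 1≤a (s≤s a≤b) b+1≤ same with a ≟ b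
... | yes refl = compatible a 1≤a b+1≤ same
... | no a≢b = <-trans (Compatible⇒rowOf-< m S compatible 1≤a (≤∧≢⇒< a≤b a≢b) b≤ (trans same (sym b~b+1)))
                       (compatible b (≤-trans 1≤a a≤b) b+1≤ b~b+1)
  where
  b≤ = ≤-trans (n≤1+n b) b+1≤
  b~b+1 : blockOf m b ≡ blockOf m (suc b)
  b~b+1 = ≤-antisym (blockOf-mono m (≤-trans 1≤a a≤b) (n≤1+n b) b+1≤)
                    (subst (_≤ blockOf m b) same (blockOf-mono m 1≤a a≤b b≤))

module Destandardization (m : List ℕ) (S : Tableau) (inRange : All (All (InRange (sum m))) S)
       (unique : Unique (concat S)) (complete : ∀ {L} → InRange (sum m) L → L ∈ concat S)
       (compatible : Compatible m S) where

  open Standardization m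

  rowOf-< : ∀ {a b} → InRange (sum m) a → InRange (sum m) b → a < b → blockOf m a ≡ blockOf m b → rowOf a S < rowOf b S
  rowOf-< (1≤a , _) (_ , b≤) a<b = Compatible⇒rowOf-< m S compatible 1≤a a<b b≤

  concat-inRange : All (InRange (sum m)) (concat S)
  concat-inRange = All.concat⁺ inRange

  destandardize-inRange : All (All (InRange (length m))) (destandardize m S)
  destandardize-inRange = All.map⁺ (All.map (λ r-inRange → All.map⁺ (All.map (letter-inRange m) r-inRange)) inRange)

  destandardize-firstColumn : Linked _≤_ (firstColumn S) → Linked _≤_ (firstColumn (destandardize m S))
  destandardize-firstColumn sorted = subst (Linked _≤_) (sym (firstColumn-map (letter m) S))
    (map⁺-Linked (letter m) (firstColumn-all S inRange) sorted λ (1≤a , _) (_ , b≤) a≤b → letter-mono m 1≤a a≤b b≤)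

  destandardize-rows : All (Linked _<_) S → All (Linked _<_) (destandardize m S)
  destandardize-rows rows = All.map⁺ (All.tabulate λ {r} r∈ →
    map⁺-Linked (letter m) (All.tabulate (λ a∈ → a∈ , All.lookup (All.lookup inRange r∈) a∈)) (All.lookup rows r∈) (letter-< r∈))
    where
    -- Equal letters come from one block, whose entries lie in strictly increasing rows.
    letter-< : ∀ {r} → r ∈ S → ∀ {a b} → a ∈ r × InRange (sum m) a → b ∈ r × InRange (sum m) b → a < b → letter m a < letter m b
    letter-< r∈ (a∈ , a-inRange@(1≤a , _)) (b∈ , b-inRange@(_ , b≤)) a<b =
      s≤s (≤∧≢⇒< (blockOf-mono m 1≤a (<⇒≤ a<b) b≤)
        λ same → <-irrefl (rowOf-same-row S unique r∈ a∈ b∈) (rowOf-< a-inRange b-inRange a<b same))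

  destandardize-content : Content m (concat (destandardize m S))
  destandardize-content = subst (Content m) (sym (concat-map S)) (occurrences-letter-all m unique concat-inRange complete)

  rowOf-<⇔< : ∀ {a b} → InRange (sum m) a → InRange (sum m) b → blockOf m a ≡ blockOf m b → rowOf a S < rowOf b S ⇔ a < b
  rowOf-<⇔< {a} {b} a-inRange b-inRange same = mk⇔ to (λ a<b → rowOf-< a-inRange b-inRange a<b same)
    where
    to : rowOf a S < rowOf b S → a < b
    to below with <-cmp a b
    ... | tri< a<b _ _ = a<b
    ... | tri≈ _ refl _ = ⊥-elim (<-irrefl refl below)
    ... | tri> _ _ b<a = ⊥-elim (<-asym below (rowOf-< b-inRange a-inRange b<a (sym same)))

  -- The entries of block y in the rows Pre below L are exactly those smaller than L.
  label-letter : ∀ Pre r rs → S ≡ Pre ++ r ∷ rs → ∀ {L} → L ∈ r → label (map (letter m) (concat Pre)) (letter m L) ≡ L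
  label-letter Pre r rs S≡ {L} L∈r = trans (cong (position y) count) (sym L≡)
    where
    concat≡ : concat S ≡ concat Pre ++ concat (r ∷ rs)
    concat≡ = trans (cong concat S≡) (sym (concat-++ Pre (r ∷ rs)))
    unique′ : Unique (concat Pre ++ concat (r ∷ rs))
    unique′ = subst Unique concat≡ unique
    L-inRange : InRange (sum m) L
    L-inRange = All.lookup concat-inRange (subst (L ∈_) (sym concat≡) (∈-++⁺ʳ (concat Pre) (∈-++⁺ˡ L∈r)))
    spec = blockOf-spec m L-inRange
    y = blockOf m L
    decomposition = InBlock⇒position (proj₂ spec)
    c = proj₁ decomposition
    c< : c < entry m y
    c< = proj₁ (proj₂ decomposition)
    L≡ : L ≡ position y c
    L≡ = proj₂ (proj₂ decomposition)
    rowOf-L : rowOf L S ≡ length Pre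
    rowOf-L = trans (cong (rowOf L) S≡) (trans (rowOf-++-∉ Pre (r ∷ rs) (λ L∈Pre → ++-unique⇒disjoint (concat Pre) unique′ L∈Pre (∈-++⁺ˡ L∈r)))
      (trans (cong (length Pre +_) (rowOf-∈ rs L∈r)) (+-identityʳ _)))
    meets : ∀ {L′} → InBlock m y L′ → L′ ∈ concat Pre ⇔ L′ ≤ blockStart m y + c
    meets {L′} inBlock′ =
      mk⇔ (λ L′∈ → ≤-pred (subst (L′ <_) L≡ (Equivalence.to below⇔ (subst (rowOf L′ S <_) (sym rowOf-L) (Equivalence.to in-Pre L′∈)))))
          (λ L′≤ → Equivalence.from in-Pre (subst (rowOf L′ S <_) rowOf-L (Equivalence.from below⇔ (subst (L′ <_) (sym L≡) (s≤s L′≤)))))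
      where
      in-Pre : L′ ∈ concat Pre ⇔ rowOf L′ S < length Pre
      in-Pre = subst (λ T → L′ ∈ concat Pre ⇔ rowOf L′ T < length Pre) (sym S≡) (∈-concat⇔rowOf-< Pre (r ∷ rs))
      below⇔ : rowOf L′ S < rowOf L S ⇔ L′ < L
      below⇔ = rowOf-<⇔< (InBlock⇒inRange m inBlock′) L-inRange (blockOf-≡ m (proj₁ spec) inBlock′)
    count : occurrences (suc y) (map (letter m) (concat Pre)) ≡ c
    count = occurrences-letter m (++-unique⇒uniqueˡ (concat Pre) unique′)
      (All.++⁻ˡ (concat Pre) (subst (All (InRange (sum m))) concat≡ concat-inRange)) (proj₁ spec) (<⇒≤ c<) meets

  standardizeAbove-destandardize : ∀ Pre rs → S ≡ Pre ++ rs →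
    standardizeAbove (map (letter m) (concat Pre)) (destandardize m rs) ≡ rs
  standardizeAbove-destandardize Pre [] _ = refl
  standardizeAbove-destandardize Pre (r ∷ rs) S≡ =
    cong₂ _∷_ (trans (sym (map-∘ r)) (map-id-local (All.tabulate (label-letter Pre r rs S≡))))
      (trans (cong (λ B → standardizeAbove B (destandardize m rs)) B≡)
        (standardizeAbove-destandardize (Pre ++ r ∷ []) rs (trans S≡ (sym (++-assoc Pre (r ∷ []) rs)))))
    where
    B≡ : map (letter m) (concat Pre) ++ map (letter m) r ≡ map (letter m) (concat (Pre ++ r ∷ []))
    B≡ = trans (sym (map-++ (letter m) (concat Pre) r))
      (cong (map (letter m)) (trans (cong (concat Pre ++_) (sym (++-identityʳ r))) (concat-++ Pre (r ∷ []))))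

  standardize-destandardize : standardize (destandardize m S) ≡ S
  standardize-destandardize = standardizeAbove-destandardize [] S refl

ones-content⇒ : ∀ n xs → map (λ v → occurrences v xs) (oneTo (length (ones n))) ≡ ones n →
  ∀ L → InRange n L → occurrences L xs ≡ 1
ones-content⇒ n xs content (suc y) (_ , y<n) =
  trans (map-oneTo-length≡⇒ _ (ones n) content y (subst (y <_) (sym (length-ones n)) y<n)) (entry-ones n y y<n)

ones-content⇐ : ∀ n xs → (∀ L → InRange n L → occurrences L xs ≡ 1) →
  map (λ v → occurrences v xs) (oneTo (length (ones n))) ≡ ones n
ones-content⇐ n xs once = map-oneTo-length≡⇐ _ (ones n) λ y y< →
  let y<n = subst (y <_) (length-ones n) y< in trans (once (suc y) (s≤s z≤n , y<n)) (sym (entry-ones n y y<n))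

once⇒unique : ∀ {n xs} → All (InRange n) xs → (∀ L → InRange n L → occurrences L xs ≡ 1) → Unique xs
once⇒unique {n} {xs} inRange once = occurrences≤1⇒unique xs occurrences≤1
  where
  occurrences≤1 : ∀ L → occurrences L xs ≤ 1
  occurrences≤1 L with (1 ≤? L) ×-dec (L ≤? n)
  ... | yes L-inRange = ≤-reflexive (once L L-inRange)
  ... | no L∉ = subst (_≤ 1) (sym (occurrences-outside inRange L∉)) z≤n

once⇒complete : ∀ {n xs} → (∀ L → InRange n L → occurrences L xs ≡ 1) → ∀ {L} → InRange n L → L ∈ xs
once⇒complete {xs = xs} once {L} L-inRange with L ∈? xs
... | yes L∈ = L∈
... | no L∉ = ⊥-elim (0≢1+n (trans (sym (occurrences-∉ xs L∉)) (once L L-inRange)))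

length-permutation : ∀ {n xs} → Unique xs → All (InRange n) xs → (∀ {L} → InRange n L → L ∈ xs) → length xs ≡ n
length-permutation {n} uxs inRange complete =
  trans (length-≡-of-same-elements uxs (oneTo-unique n) (∈-oneTo⁺ ∘ All.lookup inRange) (complete ∘ ∈-oneTo⁻)) (length-oneTo n)

module _ (m : List ℕ) where
  open Standardization m

  standardize-standard : ∀ U → All (λ r → 0 < length r) U → All (All (InRange (length m))) U → HasContent m U →
    ((length (concat U) ≡ sum m × All (All (InRange (sum m))) (standardize U)) ×
     HasContent (ones (sum m)) (standardize U) × Compatible m (standardize U)) ×
    destandardize m (standardize U) ≡ U
  standardize-standard U nonempty inRange ((_ , sorted , rows) , content) =
    ((length≡ , S-inRange) ,
    ((All.map (All.map proj₁) S-inRange ,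
      standardizeAbove-firstColumn [] U content′ strict nonempty sorted ,
      standardizeAbove-rows [] U content′ strict) ,
     ones-content⇐ (sum m) (concat S) once) ,
    standardize-compatible U content′ strict) ,
    destandardize-standardizeAbove [] U content′ strict
    where
    S = standardize U
    content′ : Content m (concat U)
    content′ = map-oneTo-length≡⇒ _ m content
    strict : StrictRows (length m) U
    strict = All.zip (inRange , rows)
    S-inRange = standardizeAbove-inRange [] U content′ strict
    once = occurrences-standardize U content′ strict
    length≡ : length (concat U) ≡ sum m
    length≡ = begin
      length (concat U)        ≡⟨ length-concat U ⟩
      sum (map length U)       ≡⟨ cong sum (sym (standardizeAbove-shape [] U)) ⟩
      sum (map length S)       ≡⟨ sym (length-concat S) ⟩
      length (concat S)        ≡⟨ length-permutation (once⇒unique (All.concat⁺ S-inRange) once) (All.concat⁺ S-inRange) (once⇒complete once) ⟩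
      sum m                    ∎
      where open ≡-Reasoning

  destandardize-standard : ∀ n S → All (All (InRange n)) S → HasContent (ones n) S →
    AdmitsSortedWord (descents n S) n m →
    (All (All (InRange (length m))) (destandardize m S) × HasContent m (destandardize m S)) × standardize (destandardize m S) ≡ S
  destandardize-standard .(sum m) S inRange ((_ , sorted , rows) , content) (refl , admissible) =
    (destandardize-inRange ,
     (All.map (All.map proj₁) destandardize-inRange , destandardize-firstColumn sorted , destandardize-rows rows) ,
     map-oneTo-length≡⇐ _ m destandardize-content) ,
    standardize-destandardize
    where
    once = ones-content⇒ (sum m) (concat S) content
    open Destandardization m S inRange (once⇒unique (All.concat⁺ inRange) once) (once⇒complete once)
      (admissible⇒compatible m S admissible)

coeffRS-≡-count-standard : ∀ α → All (λ a → 0 < a) α → ∀ m →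
  coeffRS α m ≡ length (filter (λ S → admitsSortedWord? (descents (sum α) S) (sum α) m) (standardTableaux α))
coeffRS-≡-count-standard α positive m =
  length-filter-≡-by-inverses (hasContent? m) (λ S → admitsSortedWord? (descents n S) n m)
    (fillings (length m) α) (standardTableaux α) (fillings-unique (length m) α) (Unique.filter⁺ (hasContent? (ones n)) {fillings n α} (fillings-unique n α))
    standardize (destandardize m) forward backward
  where
  n = sum α
  open Standardization m

  forward : ∀ U → U ∈ fillings (length m) α → HasContent m U →
    (standardize U ∈ standardTableaux α × AdmitsSortedWord (descents n (standardize U)) n m) × destandardize m (standardize U) ≡ U
  forward U U∈ hasContent =
    let (shape , inRange) = ∈-fillings⁻ α U∈
        nonempty = All.map⁻ (subst (All (λ a → 0 < a)) (sym shape) positive)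
        ((length≡ , S-inRange) , standard , compatible) , inverse = standardize-standard m U nonempty inRange hasContent
        n≡ = trans (cong sum (sym shape)) (trans (sym (length-concat U)) length≡)
        S∈fillings = subst₂ (λ k β → standardize U ∈ fillings k β) (sym n≡) (trans (standardizeAbove-shape [] U) shape)
          (∈-fillings⁺ (standardize U) S-inRange)
    in (∈-filter⁺ (hasContent? (ones n)) S∈fillings (subst (λ k → HasContent (ones k) (standardize U)) (sym n≡) standard) ,
        n≡ , subst (λ k → Admissible (descents k (standardize U)) 1 (sortedWord m)) (sym n≡) (compatible⇒admissible m (standardize U) compatible)) ,
       inverse

  backward : ∀ S → S ∈ standardTableaux α → AdmitsSortedWord (descents n S) n m →
    (destandardize m S ∈ fillings (length m) α × HasContent m (destandardize m S)) × standardize (destandardize m S) ≡ S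
  backward S S∈ admits =
    let (S∈fillings , standard) = ∈-filter⁻ (hasContent? (ones n)) {xs = fillings n α} S∈
        (shape , inRange) = ∈-fillings⁻ α S∈fillings
        (letters-inRange , hasContent) , inverse = destandardize-standard m n S inRange standard admits
    in (subst (λ β → destandardize m S ∈ fillings (length m) β) (trans (destandardize-shape m S) shape) (∈-fillings⁺ _ letters-inRange) ,
        hasContent) ,
       inverse

theorem3p5 : (α : List ℕ) → All (λ a → 0 < a) α → (m : List ℕ) →
    coeffRS α m ≡ sum (map (λ S → coeffF (comp (sum α) (descents (sum α) S)) m) (standardTableaux α))
theorem3p5 α positive m = begin
  coeffRS α m
    ≡⟨ coeffRS-≡-count-standard α positive m ⟩
  length (filter (λ S → admitsSortedWord? (descents n S) n m) (standardTableaux α))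
    ≡⟨ sum-map-indicator (λ S → admitsSortedWord? (descents n S) n m) (standardTableaux α) ⟨
  sum (map (λ S → indicator (admitsSortedWord? (descents n S) n m)) (standardTableaux α))
    ≡⟨ cong sum (map-cong (λ S → coeffF-comp-descents m n S) (standardTableaux α)) ⟨
  sum (map (λ S → coeffF (comp n (descents n S)) m) (standardTableaux α)) ∎
  where
  open ≡-Reasoning
  n = sum α
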